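{- Let $m,k$ be positive integers, $x\in L_m\cap kP_m$, $i\in\{1,2\}$ and $A=(a_1,\dots,a_m)\in\{0,1,2\}^m$ with $a_1+\dots+a_m\equiv 2\pmod 3$. Then $S_i(x,A)\equiv 2k\pmod 3$.
   Context: Here $P_m\subseteq\mathbb{R}^{3m}$ with coordinates $x_g^j$, $g\in\mathbb{Z}_3=\{0,1,2\}$, $1\le j\le m$; $x(g_1,\dots,g_m)$ has $x_g^j=1$ if $g=g_j$ and $0$ otherwise; $P_m=\operatorname{conv}\{x(g_1,\dots,g_m):\sum g_j=0\in\mathbb{Z}_3\}$ and $L_m$ is the lattice generated by its vertices. Write $x^j=(x_0^j,x_1^j,x_2^j)$, $u_0=(0,1,2)$, $u_1=(1,2,0)$, $u_2=(2,0,1)$, $w_0=(0,2,1)$, $w_1=(1,0,2)$, $w_2=(2,1,0)$, and $S_1(x,A)=\sum_{j=1}^m\langle u_{a_j},x^j\rangle$, $S_2(x,A)=\sum_{j=1}^m\langle w_{a_j},x^j\rangle$. -}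

module Defs where

open import Data.Nat as ℕ using (ℕ; zero; suc)
open import Data.Fin using (Fin; zero; suc; toℕ; _≟_)
open import Data.Integer as ℤ using (ℤ; +_)
open import Data.Integer.Divisibility using (_∣_)
open import Data.Rational as ℚ using (ℚ)
open import Data.List using (List; []; _∷_)
open import Data.List.Relation.Unary.All using (All)
open import Data.Product using (Σ; _×_; ∃; _,_; proj₁; proj₂)
open import Relation.Binary.PropositionalEquality using (_≡_)
open import Relation.Nullary using (does)
open import Data.Bool using (if_then_else_)

-- ℤ₃ is modelled by Fin 3 (elements 0,1,2).
-- A point of ℝ^{3m} with integer coordinates: x j g = x_g^j  (j : Fin m, g : Fin 3)
Point : ℕ → Set
Point m = Fin m → Fin 3 → ℤ

ΣFinℕ : (m : ℕ) → (Fin m → ℕ) → ℕ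
ΣFinℕ zero    f = 0
ΣFinℕ (suc m) f = f zero ℕ.+ ΣFinℕ m (λ j → f (suc j))

ΣFinℤ : (m : ℕ) → (Fin m → ℤ) → ℤ
ΣFinℤ zero    f = + 0
ΣFinℤ (suc m) f = f zero ℤ.+ ΣFinℤ m (λ j → f (suc j))

ValidLabel : (m : ℕ) → (Fin m → Fin 3) → Set
ValidLabel m g = ΣFinℕ m (λ j → toℕ (g j)) ℕ.% 3 ≡ 0

vertex : (m : ℕ) → (Fin m → Fin 3) → Point m
vertex m gs j g = if does (g ≟ gs j) then + 1 else + 0

Vertex : ℕ → Set
Vertex m = Σ (Fin m → Fin 3) (ValidLabel m)

lincombℤ : (m : ℕ) → List (Vertex m × ℤ) → Point m
lincombℤ m []              j g = + 0
lincombℤ m ((v , c) ∷ cs) j g = c ℤ.* vertex m (proj₁ v) j g ℤ.+ lincombℤ m cs j g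

InL : (m : ℕ) → Point m → Set
InL m x = ∃ λ (cs : List (Vertex m × ℤ)) → lincombℤ m cs ≡ x

toℚ : ℤ → ℚ
toℚ z = z ℚ./ 1

lincombℚ : (m : ℕ) → List (Vertex m × ℚ) → Fin m → Fin 3 → ℚ
lincombℚ m []              j g = ℚ.0ℚ
lincombℚ m ((v , c) ∷ cs) j g = c ℚ.* toℚ (vertex m (proj₁ v) j g) ℚ.+ lincombℚ m cs j g

sumCoeffs : {m : ℕ} → List (Vertex m × ℚ) → ℚ
sumCoeffs []             = ℚ.0ℚ
sumCoeffs ((_ , c) ∷ cs) = c ℚ.+ sumCoeffs cs

InkP : (m k : ℕ) → Point m → Set
InkP m k x = ∃ λ (cs : List (Vertex m × ℚ)) →
  All (λ p → ℚ.0ℚ ℚ.≤ proj₂ p) cs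
  × sumCoeffs cs ≡ toℚ (+ k)
  × (∀ j g → lincombℚ m cs j g ≡ toℚ (x j g))

u : Fin 3 → Fin 3 → ℤ
u zero             zero             = + 0
u zero             (suc zero)       = + 1
u zero             (suc (suc zero)) = + 2
u (suc zero)       zero             = + 1
u (suc zero)       (suc zero)       = + 2
u (suc zero)       (suc (suc zero)) = + 0
u (suc (suc zero)) zero             = + 2
u (suc (suc zero)) (suc zero)       = + 0
u (suc (suc zero)) (suc (suc zero)) = + 1

w : Fin 3 → Fin 3 → ℤ
w zero             zero             = + 0
w zero             (suc zero)       = + 2
w zero             (suc (suc zero)) = + 1
w (suc zero)       zero             = + 1
w (suc zero)       (suc zero)       = + 0
w (suc zero)       (suc (suc zero)) = + 2
w (suc (suc zero)) zero             = + 2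
w (suc (suc zero)) (suc zero)       = + 1
w (suc (suc zero)) (suc (suc zero)) = + 0

inner : (Fin 3 → ℤ) → (Fin 3 → ℤ) → ℤ
inner v y = v zero ℤ.* y zero ℤ.+ v (suc zero) ℤ.* y (suc zero)
            ℤ.+ v (suc (suc zero)) ℤ.* y (suc (suc zero))

S₁ : (m : ℕ) → Point m → (Fin m → Fin 3) → ℤ
S₁ m x A = ΣFinℤ m (λ j → inner (u (A j)) (x j))

S₂ : (m : ℕ) → Point m → (Fin m → Fin 3) → ℤ
S₂ m x A = ΣFinℤ m (λ j → inner (w (A j)) (x j))

-- S_i for i ∈ {1,2}, indexed by Fin 2 (zero ↦ i=1, suc zero ↦ i=2)
S : Fin 2 → (m : ℕ) → Point m → (Fin m → Fin 3) → ℤ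
S zero       = S₁
S (suc zero) = S₂

_≡₃_ : ℤ → ℤ → Set
a ≡₃ b = (+ 3) ∣ (a ℤ.- b)

-- On a vertex x(g) the j-th block is the unit vector e_{g_j}, and ⟨u_a, e_g⟩ ≡ a + g,
-- ⟨w_a, e_g⟩ ≡ a − g (mod 3); summing over j gives S_i(x(g), A) ≡ Σ a_j ± Σ g_j ≡ 2 + 0.
-- Since S_i is linear, a lattice point x = Σ c_v v has S_i(x, A) ≡ 2 Σ c_v. Every block of
-- every vertex sums to 1, so one block of x sums both to Σ c_v (x ∈ L_m) and to k (x ∈ kP_m),
-- whence Σ c_v = k.
module Submission where

open import Defs
open import Data.Fin using (Fin; toℕ)
open import Data.Integer using (+_)
open import Relation.Binary.PropositionalEquality using (_≡_)

open import Algebra.Bundles using (Semiring; Ring)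
open import Data.Vec.Functional using (Vector)

module _ {c ℓ} (R : Semiring c ℓ) where
  open Semiring R
  open import Algebra.Properties.Semiring.Sum R using (sum; ∑-distrib-+; *-distribˡ-sum)

  sum-affine : ∀ {n} a (e y : Vector Carrier n) → sum e ≈ 1# →
               sum (λ g → a * e g + y g) ≈ a + sum y
  sum-affine a e y Σe≈1 = trans (∑-distrib-+ (λ g → a * e g) y)
    (+-congʳ (trans (sym (*-distribˡ-sum a e)) (trans (*-congˡ Σe≈1) (*-identityʳ a))))

-- Integer and rational arithmetic are opened only inside this block: the statement of
-- lemma5p2 needs ℕ's _*_.
module _ where
  open import Data.Nat as ℕ using (ℕ)
  open import Data.Nat.DivMod using (m≡m%n+[m/n]*n)
  open import Data.Fin using (zero; suc; _≟_)
  open import Data.Fin.Properties using (all?)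
  open import Data.Bool using (if_then_else_)
  open import Data.Integer using (ℤ; _+_; _-_; -_; _*_)
  open import Data.Integer.Properties using (pos-+; pos-*; *-zeroʳ; *-identityʳ; +-*-semiring)
  import Data.Rational as ℚ
  import Data.Rational.Properties as ℚP
  open import Data.Rational.Unnormalised using (mkℚᵘ; *≡*)
  import Data.Rational.Unnormalised as ℚᵘ
  import Data.Rational.Unnormalised.Properties as ℚᵘP
  open import Data.Integer.Divisibility.Signed
    using (_∣_; divides; _∣?_; ∣m∣n⇒∣m+n; ∣m⇒∣-m; ∣n⇒∣m*n)
  open import Data.Integer.Tactic.RingSolver using (solve-∀)
  open import Data.List using (List; []; _∷_)
  open import Data.Product using (_×_; _,_)
  open import Level using (0ℓ)
  open import Relation.Binary.Bundles using (Setoid)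
  open import Relation.Binary.PropositionalEquality
    using (refl; sym; trans; cong; cong₂; subst; module ≡-Reasoning)
  open import Relation.Nullary using (does)
  open import Relation.Nullary.Decidable using (Dec; from-yes; map′)
  import Relation.Binary.Reasoning.Setoid as SetoidReasoning
  import Algebra.Properties.Semiring.Sum as SemiringSum

  infix 4 _≡_mod_
  record _≡_mod_ (a b n : ℤ) : Set where
    constructor ≡-mod
    field ∣-difference : n ∣ a - b
  open _≡_mod_ public

  module _ {n : ℤ} where

    ≡⇒≡-mod : ∀ {a b} → a ≡ b → a ≡ b mod n
    ≡⇒≡-mod {a} refl = ≡-mod (divides (+ 0) (identity a n))
      where
      identity : ∀ a n → a - a ≡ + 0 * n
      identity = solve-∀

    ≡-mod-sym : ∀ {a b} → a ≡ b mod n → b ≡ a mod n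
    ≡-mod-sym {a} {b} (≡-mod n∣a-b) = ≡-mod (subst (n ∣_) (negate a b) (∣m⇒∣-m n∣a-b))
      where
      negate : ∀ a b → - (a - b) ≡ b - a
      negate = solve-∀

    ≡-mod-trans : ∀ {a b c} → a ≡ b mod n → b ≡ c mod n → a ≡ c mod n
    ≡-mod-trans {a} {b} {c} (≡-mod n∣a-b) (≡-mod n∣b-c) =
      ≡-mod (subst (n ∣_) (telescope a b c) (∣m∣n⇒∣m+n n∣a-b n∣b-c))
      where
      telescope : ∀ a b c → (a - b) + (b - c) ≡ a - c
      telescope = solve-∀

    +-cong-mod : ∀ {a b c d} → a ≡ b mod n → c ≡ d mod n → a + c ≡ b + d mod n
    +-cong-mod {a} {b} {c} {d} (≡-mod n∣a-b) (≡-mod n∣c-d) =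
      ≡-mod (subst (n ∣_) (interchange a b c d) (∣m∣n⇒∣m+n n∣a-b n∣c-d))
      where
      interchange : ∀ a b c d → (a - b) + (c - d) ≡ (a + c) - (b + d)
      interchange = solve-∀

    *-congˡ-mod : ∀ k {a b} → a ≡ b mod n → k * a ≡ k * b mod n
    *-congˡ-mod k {a} {b} (≡-mod n∣a-b) = ≡-mod (subst (n ∣_) (distrib k a b) (∣n⇒∣m*n k n∣a-b))
      where
      distrib : ∀ k a b → k * (a - b) ≡ k * a - k * b
      distrib = solve-∀

  ≡-mod-setoid : ℤ → Setoid 0ℓ 0ℓ
  ≡-mod-setoid n = record
    { Carrier = ℤ
    ; _≈_ = λ a b → a ≡ b mod n
    ; isEquivalence = record { refl = ≡⇒≡-mod refl ; sym = ≡-mod-sym ; trans = ≡-mod-trans }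
    }

  infix 4 _≡?_mod_
  _≡?_mod_ : ∀ a b n → Dec (a ≡ b mod n)
  a ≡? b mod n = map′ ≡-mod ∣-difference (n ∣? (a - b))

  ≡-mod-% : ∀ m d .{{_ : ℕ.NonZero d}} → + m ≡ + (m ℕ.% d) mod + d
  ≡-mod-% m d = ≡-mod (divides (+ (m ℕ./ d)) (begin
    + m - + r                ≡⟨ cong (λ t → + t - + r) (m≡m%n+[m/n]*n m d) ⟩
    + (r ℕ.+ q ℕ.* d) - + r  ≡⟨ cong (_- + r) (trans (pos-+ r (q ℕ.* d)) (cong (λ t → + r + t) (pos-* q d))) ⟩
    + r + + q * + d - + r    ≡⟨ cancel (+ r) (+ q * + d) ⟩
    + q * + d                ∎))
    where
    open ≡-Reasoning
    r = m ℕ.% d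
    q = m ℕ./ d
    cancel : ∀ r s → r + s - r ≡ s
    cancel = solve-∀

  module ℤΣ = SemiringSum +-*-semiring

  ΣFinℤ≡sum : ∀ m f → ΣFinℤ m f ≡ ℤΣ.sum f
  ΣFinℤ≡sum ℕ.zero    f = refl
  ΣFinℤ≡sum (ℕ.suc m) f = cong (λ s → f zero + s) (ΣFinℤ≡sum m (λ j → f (suc j)))

  ΣFinℤ-cong : ∀ m {f g : Fin m → ℤ} → (∀ j → f j ≡ g j) → ΣFinℤ m f ≡ ΣFinℤ m g
  ΣFinℤ-cong m {f} {g} f≗g = trans (ΣFinℤ≡sum m f) (trans (ℤΣ.sum-cong-≗ f≗g) (sym (ΣFinℤ≡sum m g)))

  ΣFinℤ-affine : ∀ m c f g → ΣFinℤ m (λ j → c * f j + g j) ≡ c * ΣFinℤ m f + ΣFinℤ m g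
  ΣFinℤ-affine m c f g = begin
    ΣFinℤ m (λ j → c * f j + g j)        ≡⟨ ΣFinℤ≡sum m _ ⟩
    ℤΣ.sum (λ j → c * f j + g j)         ≡⟨ ℤΣ.∑-distrib-+ (λ j → c * f j) g ⟩
    ℤΣ.sum (λ j → c * f j) + ℤΣ.sum g    ≡⟨ cong (_+ ℤΣ.sum g) (sym (ℤΣ.*-distribˡ-sum c f)) ⟩
    c * ℤΣ.sum f + ℤΣ.sum g              ≡⟨ cong₂ (λ s t → c * s + t) (ΣFinℤ≡sum m f) (ΣFinℤ≡sum m g) ⟨
    c * ΣFinℤ m f + ΣFinℤ m g            ∎
    where open ≡-Reasoning

  ΣFinℤ-zero : ∀ m → ΣFinℤ m (λ _ → + 0) ≡ + 0
  ΣFinℤ-zero m = trans (ΣFinℤ≡sum m _) (ℤΣ.sum-replicate-zero m)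

  ΣFinℤ-cong-mod : ∀ {n} m {f g : Fin m → ℤ} → (∀ j → f j ≡ g j mod n) → ΣFinℤ m f ≡ ΣFinℤ m g mod n
  ΣFinℤ-cong-mod ℕ.zero    f≡g = ≡⇒≡-mod refl
  ΣFinℤ-cong-mod (ℕ.suc m) f≡g = +-cong-mod (f≡g zero) (ΣFinℤ-cong-mod m (λ j → f≡g (suc j)))

  +-ΣFinℕ : ∀ m f → + ΣFinℕ m f ≡ ΣFinℤ m (λ j → + f j)
  +-ΣFinℕ ℕ.zero    f = refl
  +-ΣFinℕ (ℕ.suc m) f =
    trans (pos-+ (f zero) _) (cong (λ s → + f zero + s) (+-ΣFinℕ m (λ j → f (suc j))))

  unitVector : Fin 3 → Fin 3 → ℤ
  unitVector b g = if does (g ≟ b) then + 1 else + 0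

  inner-unitVector : ∀ V b → inner V (unitVector b) ≡ V b
  inner-unitVector V zero             = first (V zero) (V (suc zero)) (V (suc (suc zero)))
    where
    first : ∀ a b c → a * + 1 + b * + 0 + c * + 0 ≡ a
    first = solve-∀
  inner-unitVector V (suc zero)       = second (V zero) (V (suc zero)) (V (suc (suc zero)))
    where
    second : ∀ a b c → a * + 0 + b * + 1 + c * + 0 ≡ b
    second = solve-∀
  inner-unitVector V (suc (suc zero)) = third (V zero) (V (suc zero)) (V (suc (suc zero)))
    where
    third : ∀ a b c → a * + 0 + b * + 0 + c * + 1 ≡ c
    third = solve-∀

  inner-affine : ∀ V c y z → inner V (λ g → c * y g + z g) ≡ c * inner V y + inner V z
  inner-affine V c y z = expand (V zero) (V (suc zero)) (V (suc (suc zero)))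
                                (y zero) (y (suc zero)) (y (suc (suc zero)))
                                (z zero) (z (suc zero)) (z (suc (suc zero))) c
    where
    expand : ∀ v₀ v₁ v₂ y₀ y₁ y₂ z₀ z₁ z₂ c →
      v₀ * (c * y₀ + z₀) + v₁ * (c * y₁ + z₁) + v₂ * (c * y₂ + z₂)
      ≡ c * (v₀ * y₀ + v₁ * y₁ + v₂ * y₂) + (v₀ * z₀ + v₁ * z₁ + v₂ * z₂)
    expand = solve-∀

  inner-zero : ∀ V → inner V (λ _ → + 0) ≡ + 0
  inner-zero V = vanish (V zero) (V (suc zero)) (V (suc (suc zero)))
    where
    vanish : ∀ a b c → a * + 0 + b * + 0 + c * + 0 ≡ + 0
    vanish = solve-∀

  pairing : (m : ℕ) → (Fin m → Fin 3 → ℤ) → Point m → ℤ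
  pairing m V x = ΣFinℤ m (λ j → inner (V j) (x j))

  pairing-affine : ∀ m V c (y z : Point m) →
    pairing m V (λ j g → c * y j g + z j g) ≡ c * pairing m V y + pairing m V z
  pairing-affine m V c y z =
    trans (ΣFinℤ-cong m (λ j → inner-affine (V j) c (y j) (z j))) (ΣFinℤ-affine m c _ _)

  pairing-zero : ∀ m V → pairing m V (λ _ _ → + 0) ≡ + 0
  pairing-zero m V = trans (ΣFinℤ-cong m (λ j → inner-zero (V j))) (ΣFinℤ-zero m)

  sumCoeffsℤ : ∀ {m} → List (Vertex m × ℤ) → ℤ
  sumCoeffsℤ []             = + 0
  sumCoeffsℤ ((_ , c) ∷ cs) = c + sumCoeffsℤ cs

  pairing-lincombℤ : ∀ {n r} m V → (∀ gs → ValidLabel m gs → pairing m V (vertex m gs) ≡ r mod n) →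
                     ∀ cs → pairing m V (lincombℤ m cs) ≡ r * sumCoeffsℤ cs mod n
  pairing-lincombℤ {r = r} m V onVertex [] = ≡⇒≡-mod (trans (pairing-zero m V) (sym (*-zeroʳ r)))
  pairing-lincombℤ {n} {r} m V onVertex (((gs , valid) , c) ∷ cs) = begin
    pairing m V (lincombℤ m (((gs , valid) , c) ∷ cs))
      ≡⟨ pairing-affine m V c (vertex m gs) (lincombℤ m cs) ⟩
    c * pairing m V (vertex m gs) + pairing m V (lincombℤ m cs)
      ≈⟨ +-cong-mod (*-congˡ-mod c (onVertex gs valid)) (pairing-lincombℤ m V onVertex cs) ⟩
    c * r + r * sumCoeffsℤ cs
      ≡⟨ factor c r (sumCoeffsℤ cs) ⟩
    r * (c + sumCoeffsℤ cs) ∎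
    where
    open SetoidReasoning (≡-mod-setoid n)
    factor : ∀ c r s → c * r + r * s ≡ r * (c + s)
    factor = solve-∀

  form : Fin 2 → Fin 3 → Fin 3 → ℤ
  form zero       = u
  form (suc zero) = w

  slope : Fin 2 → ℤ
  slope zero       = + 1
  slope (suc zero) = + 2

  S≡pairing : ∀ i m x A → S i m x A ≡ pairing m (λ j → form i (A j)) x
  S≡pairing zero       m x A = refl
  S≡pairing (suc zero) m x A = refl

  form≡affine : ∀ i a b → form i a b ≡ slope i * + toℕ b + + toℕ a mod + 3
  form≡affine = from-yes (all? λ i → all? λ a → all? λ b →
    form i a b ≡? slope i * + toℕ b + + toℕ a mod + 3)

  pairing-form-vertex : ∀ i m (A gs : Fin m → Fin 3) →
    pairing m (λ j → form i (A j)) (vertex m gs)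
    ≡ slope i * + ΣFinℕ m (λ j → toℕ (gs j)) + + ΣFinℕ m (λ j → toℕ (A j)) mod + 3
  pairing-form-vertex i m A gs = begin
    pairing m (λ j → form i (A j)) (vertex m gs)
      ≡⟨ ΣFinℤ-cong m (λ j → inner-unitVector (form i (A j)) (gs j)) ⟩
    ΣFinℤ m (λ j → form i (A j) (gs j))
      ≈⟨ ΣFinℤ-cong-mod m (λ j → form≡affine i (A j) (gs j)) ⟩
    ΣFinℤ m (λ j → slope i * + toℕ (gs j) + + toℕ (A j))
      ≡⟨ ΣFinℤ-affine m (slope i) (λ j → + toℕ (gs j)) (λ j → + toℕ (A j)) ⟩
    slope i * ΣFinℤ m (λ j → + toℕ (gs j)) + ΣFinℤ m (λ j → + toℕ (A j))
      ≡⟨ sym (cong₂ (λ s t → slope i * s + t) (+-ΣFinℕ m (λ j → toℕ (gs j)))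
                                               (+-ΣFinℕ m (λ j → toℕ (A j)))) ⟩
    slope i * + ΣFinℕ m (λ j → toℕ (gs j)) + + ΣFinℕ m (λ j → toℕ (A j)) ∎
    where open SetoidReasoning (≡-mod-setoid (+ 3))

  pairing-form-vertex≡2 : ∀ i m (A gs : Fin m → Fin 3) →
    ΣFinℕ m (λ j → toℕ (A j)) ℕ.% 3 ≡ 2 → ValidLabel m gs →
    pairing m (λ j → form i (A j)) (vertex m gs) ≡ + 2 mod + 3
  pairing-form-vertex≡2 i m A gs ΣA≡2 valid = begin
    pairing m (λ j → form i (A j)) (vertex m gs)
      ≈⟨ pairing-form-vertex i m A gs ⟩
    slope i * + Σgs + + ΣA
      ≈⟨ +-cong-mod (*-congˡ-mod (slope i) (≡-mod-% Σgs 3)) (≡-mod-% ΣA 3) ⟩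
    slope i * + (Σgs ℕ.% 3) + + (ΣA ℕ.% 3)
      ≡⟨ cong₂ (λ s t → slope i * + s + + t) valid ΣA≡2 ⟩
    slope i * + 0 + + 2
      ≡⟨ vanish (slope i) ⟩
    + 2 ∎
    where
    open SetoidReasoning (≡-mod-setoid (+ 3))
    Σgs = ΣFinℕ m (λ j → toℕ (gs j))
    ΣA  = ΣFinℕ m (λ j → toℕ (A j))
    vanish : ∀ s → s * + 0 + + 2 ≡ + 2
    vanish = solve-∀

  S-lincombℤ : ∀ i m (A : Fin m → Fin 3) → ΣFinℕ m (λ j → toℕ (A j)) ℕ.% 3 ≡ 2 →
    ∀ cs → S i m (lincombℤ m cs) A ≡ + 2 * sumCoeffsℤ cs mod + 3
  S-lincombℤ i m A ΣA≡2 cs = subst (λ s → s ≡ + 2 * sumCoeffsℤ cs mod + 3)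
    (sym (S≡pairing i m (lincombℤ m cs) A))
    (pairing-lincombℤ m (λ j → form i (A j)) (λ gs → pairing-form-vertex≡2 i m A gs ΣA≡2) cs)

  ℚ-semiring : Semiring 0ℓ 0ℓ
  ℚ-semiring = Ring.semiring ℚP.+-*-ring

  module ℚΣ = SemiringSum ℚ-semiring

  toℚ-injective : ∀ {a b} → toℚ a ≡ toℚ b → a ≡ b
  toℚ-injective {a} {b} eq with ℚP.fromℚᵘ-injective {mkℚᵘ a 0} {mkℚᵘ b 0} eq
  ... | *≡* a*1≡b*1 = trans (sym (*-identityʳ a)) (trans a*1≡b*1 (*-identityʳ b))

  toℚ-homo-+ : ∀ a b → toℚ (a + b) ≡ toℚ a ℚ.+ toℚ b
  toℚ-homo-+ a b = ℚP.toℚᵘ-injective (begin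
    ℚ.toℚᵘ (toℚ (a + b))                  ≈⟨ ℚP.toℚᵘ-fromℚᵘ (mkℚᵘ (a + b) 0) ⟩
    mkℚᵘ (a + b) 0                        ≈⟨ *≡* (regroup a b) ⟩
    mkℚᵘ a 0 ℚᵘ.+ mkℚᵘ b 0                ≈⟨ ℚᵘP.+-cong (ℚᵘP.≃-sym (ℚP.toℚᵘ-fromℚᵘ (mkℚᵘ a 0)))
                                                         (ℚᵘP.≃-sym (ℚP.toℚᵘ-fromℚᵘ (mkℚᵘ b 0))) ⟩
    ℚ.toℚᵘ (toℚ a) ℚᵘ.+ ℚ.toℚᵘ (toℚ b)    ≈⟨ ℚᵘP.≃-sym (ℚP.toℚᵘ-homo-+ (toℚ a) (toℚ b)) ⟩
    ℚ.toℚᵘ (toℚ a ℚ.+ toℚ b)              ∎)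
    where
    open ℚᵘP.≃-Reasoning
    regroup : ∀ a b → (a + b) * + 1 ≡ (a * + 1 + b * + 1) * + 1
    regroup = solve-∀

  toℚ-sum : ∀ {n} (y : Vector ℤ n) → ℚΣ.sum (λ g → toℚ (y g)) ≡ toℚ (ℤΣ.sum y)
  toℚ-sum {ℕ.zero}  y = refl
  toℚ-sum {ℕ.suc n} y = trans (cong (toℚ (y zero) ℚ.+_) (toℚ-sum (λ g → y (suc g))))
                              (sym (toℚ-homo-+ (y zero) (ℤΣ.sum (λ g → y (suc g)))))

  sum-unitVector : ∀ b → ℤΣ.sum (unitVector b) ≡ + 1
  sum-unitVector zero             = refl
  sum-unitVector (suc zero)       = refl
  sum-unitVector (suc (suc zero)) = refl

  sum-toℚ-unitVector : ∀ b → ℚΣ.sum (λ g → toℚ (unitVector b g)) ≡ ℚ.1ℚ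
  sum-toℚ-unitVector b = trans (toℚ-sum (unitVector b)) (cong toℚ (sum-unitVector b))

  sum-lincombℤ : ∀ m cs j → ℤΣ.sum (lincombℤ m cs j) ≡ sumCoeffsℤ cs
  sum-lincombℤ m []                       j = ℤΣ.sum-replicate-zero 3
  sum-lincombℤ m (((gs , _) , c) ∷ cs) j =
    trans (sum-affine +-*-semiring c (unitVector (gs j)) (lincombℤ m cs j) (sum-unitVector (gs j)))
          (cong (λ s → c + s) (sum-lincombℤ m cs j))

  sum-lincombℚ : ∀ m qs j → ℚΣ.sum (lincombℚ m qs j) ≡ sumCoeffs qs
  sum-lincombℚ m []                       j = ℚΣ.sum-replicate-zero 3
  sum-lincombℚ m (((gs , _) , c) ∷ qs) j =
    trans (sum-affine ℚ-semiring c (λ g → toℚ (unitVector (gs j) g)) (lincombℚ m qs j)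
                      (sum-toℚ-unitVector (gs j)))
          (cong (c ℚ.+_) (sum-lincombℚ m qs j))

  sumCoeffs-agree : ∀ m cs qs →
    (∀ j g → lincombℚ (ℕ.suc m) qs j g ≡ toℚ (lincombℤ (ℕ.suc m) cs j g)) →
    toℚ (sumCoeffsℤ cs) ≡ sumCoeffs qs
  sumCoeffs-agree m cs qs qs≡cs = begin
    toℚ (sumCoeffsℤ cs)                              ≡⟨ cong toℚ (sum-lincombℤ (ℕ.suc m) cs zero) ⟨
    toℚ (ℤΣ.sum (lincombℤ (ℕ.suc m) cs zero))        ≡⟨ sym (toℚ-sum (lincombℤ (ℕ.suc m) cs zero)) ⟩
    ℚΣ.sum (λ g → toℚ (lincombℤ (ℕ.suc m) cs zero g)) ≡⟨ sym (ℚΣ.sum-cong-≗ (qs≡cs zero)) ⟩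
    ℚΣ.sum (lincombℚ (ℕ.suc m) qs zero)              ≡⟨ sum-lincombℚ (ℕ.suc m) qs zero ⟩
    sumCoeffs qs                                     ∎
    where open ≡-Reasoning

open import Data.Nat using (ℕ; _≤_; _%_; _*_)
open import Data.Nat using (suc; s≤s; z≤n)
import Data.Integer as ℤ
open import Data.Integer.Properties using (pos-*)
open import Data.Integer.Divisibility.Signed using (∣⇒∣ᵤ)
open import Data.Product using (_,_)
open import Relation.Binary.PropositionalEquality using (refl; sym; trans; cong)

lemma5p2 : (m k : ℕ) → 1 ≤ m → 1 ≤ k →
    (x : Point m) → InL m x → InkP m k x →
    (i : Fin 2) → (A : Fin m → Fin 3) →
    ΣFinℕ m (λ j → toℕ (A j)) % 3 ≡ 2 →
    S i m x A ≡₃ (+ (2 * k))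
lemma5p2 (suc m) k (s≤s z≤n) _ _ (cs , refl) (qs , _ , Σqs≡k , qs≡cs) i A ΣA≡2 =
  ∣⇒∣ᵤ (∣-difference (≡-mod-trans (S-lincombℤ i (suc m) A ΣA≡2 cs) (≡⇒≡-mod twice-k)))
  where
  sumCoeffs≡k : sumCoeffsℤ cs ≡ + k
  sumCoeffs≡k = toℚ-injective (trans (sumCoeffs-agree m cs qs qs≡cs) Σqs≡k)
  twice-k : + 2 ℤ.* sumCoeffsℤ cs ≡ + (2 * k)
  twice-k = trans (cong (+ 2 ℤ.*_) sumCoeffs≡k) (sym (pos-* 2 k))
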